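{- Let $q=q_1\cdots q_k$ be a pattern of length $k$ that starts with $1$ (i.e. $q_1=1$), and let $q'=1\,(q_1+1)(q_2+1)\cdots(q_k+1)$ be the pattern of length $k+1$. Let $p$ be a permutation and let $S$ be its string of remaining entries. Then: (1) if $S$ avoids $q$, then $p$ avoids $q'$; (2) $p$ avoids $q'$ if and only if $S$ avoids $q$.
   Context: A permutation $p=p_1\cdots p_n$ contains a pattern $q$ (a permutation of $[k]$) if there are indices $i_1<\dots<i_k$ with $p_{i_a}<p_{i_b}$ iff $q_a<q_b$; otherwise $p$ avoids $q$. An entry $p_i$ is a left-to-right minimum if $p_j>p_i$ for all $j<i$. The entries that are not left-to-right minima are called remaining entries; the string of remaining entries of $p$ is the subsequence of $p$ formed by them (in their order in $p$), and pattern containment for such a string is defined in the same way. -}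

module Defs where

open import Data.Nat using (ℕ; suc; _<_; _<ᵇ_)
open import Data.Bool using (Bool; if_then_else_)
open import Data.List using (List; []; _∷_; _++_; [_]; length; lookup; map; upTo)
open import Data.Bool.ListAction using (all)
open import Data.Fin using (Fin; cast)
open import Data.Product using (Σ; _×_; ∃)
open import Function.Bundles using (_⇔_)
open import Relation.Binary.PropositionalEquality using (_≡_)
open import Relation.Nullary using (¬_)
open import Data.List.Relation.Binary.Permutation.Propositional using (_↭_)
open import Data.List.Relation.Binary.Sublist.Propositional using (_⊆_)

IsPerm : List ℕ → Set
IsPerm p = p ↭ map suc (upTo (length p))

OrderIso : List ℕ → List ℕ → Set
OrderIso s q = Σ (length s ≡ length q) λ eq →
  (a b : Fin (length s)) → (lookup s a < lookup s b) ⇔ (lookup q (cast eq a) < lookup q (cast eq b))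

Contains : List ℕ → List ℕ → Set
Contains p q = ∃ λ s → (s ⊆ p) × OrderIso s q

Avoids : List ℕ → List ℕ → Set
Avoids p q = ¬ Contains p q

-- remaining-from acc xs: acc is the list of entries preceding xs in p.
-- An entry x is a left-to-right minimum iff x is smaller than every preceding entry;
-- otherwise it is a remaining entry and is kept.
remaining-from : List ℕ → List ℕ → List ℕ
remaining-from acc [] = []
remaining-from acc (x ∷ xs) =
  (if all (x <ᵇ_) acc then [] else [ x ]) ++ remaining-from (acc ++ [ x ]) xs

remaining : List ℕ → List ℕ
remaining p = remaining-from [] p

shiftPattern : List ℕ → List ℕ
shiftPattern q = 1 ∷ map suc q

-- If y t is an occurrence of 1 (q+1) in p, then y lies below every entry of t, so each entry of t
-- follows a smaller one: t consists of remaining entries and is an occurrence of q in the string S.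
-- Conversely, let x t be an occurrence of q in S. Since q starts with its minimum 1, x is below
-- every entry of t; being a remaining entry, x is preceded in p by some y ≤ x, and y < x because
-- the entries of p are distinct. Hence y x t is an occurrence of 1 (q+1) in p.
module Submission where

open import Defs
open import Data.Nat using (ℕ; suc; _<_; _≤_; _<ᵇ_; s≤s; s<s; s<s⁻¹; z≤n)
open import Data.Nat.Properties
  using (<-irrefl; <-asym; <-≤-trans; ≮⇒≥; ≤⇒≯; ≤∧≢⇒<; <ᵇ⇒<; <⇒<ᵇ; suc-injective)
open import Data.Bool using (true; false; T)
open import Data.Bool.ListAction using (all)
open import Data.List using (List; []; _∷_; _++_; [_]; length; lookup; map; upTo)
open import Data.List.Properties using (length-map; ++-assoc; tabulate-lookup)
open import Data.Fin using (Fin; zero; suc; cast)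
open import Data.Fin.Properties using (cast-trans)
open import Data.List.Membership.Propositional using (_∈_; find)
open import Data.List.Membership.Propositional.Properties using (∈-lookup; ∈-++⁺ˡ; ∈-++⁺ʳ)
open import Data.List.Relation.Unary.All as All using (All; []; _∷_)
open import Data.List.Relation.Unary.All.Properties using (all⁺; all⁻; ¬All⇒Any¬; tabulate⁺)
import Data.List.Relation.Unary.All.Properties as All
open import Data.List.Relation.Unary.Any using (here)
open import Data.List.Relation.Unary.AllPairs using (AllPairs; []; _∷_)
open import Data.List.Relation.Unary.Unique.Propositional using (Unique)
open import Data.List.Relation.Unary.Unique.Propositional.Properties using (upTo⁺)
import Data.List.Relation.Unary.Unique.Propositional.Properties as Unique
open import Data.List.Relation.Binary.Sublist.Propositional
  using (_⊆_; _⊇_; []; _∷_; _∷ʳ_; ⊆-trans; from∈)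
open import Data.List.Relation.Binary.Sublist.Propositional.Properties
  using (All-resp-⊆; ++⁺; ++⁺ˡ)
open import Data.List.Relation.Binary.Permutation.Propositional as ↭ using (_↭_; ↭-sym)
open import Data.List.Relation.Binary.Permutation.Propositional.Properties using (All-resp-↭)
open import Data.Product using (_×_; ∃; _,_)
open import Data.Empty using (⊥-elim)
open import Function using (_∘_; _⇔_; mk⇔; Equivalence)
open import Function.Construct.Composition using (_⇔-∘_)
open import Function.Construct.Symmetry using (⇔-sym)
open import Level using (Level)
open import Relation.Binary.Core using (Rel)
open import Relation.Binary.Definitions using (Symmetric; _Respects_)
open import Relation.Binary.PropositionalEquality
  using (_≡_; _≢_; refl; sym; trans; cong; subst; subst₂; ≢-sym)
open import Relation.Nullary using (¬_)
open import Relation.Nullary.Decidable using (T?)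

private
  variable
    a b r : Level
    A : Set a
    B : Set b

AllPairs-resp-⊆ : {R : Rel A r} → (AllPairs R) Respects _⊇_
AllPairs-resp-⊆ []         []           = []
AllPairs-resp-⊆ (_ ∷ʳ τ)   (_ ∷ rxs)    = AllPairs-resp-⊆ τ rxs
AllPairs-resp-⊆ (refl ∷ τ) (rx ∷ rxs)   = All-resp-⊆ τ rx ∷ AllPairs-resp-⊆ τ rxs

AllPairs-resp-↭ : {R : Rel A r} → Symmetric R → (AllPairs R) Respects _↭_
AllPairs-resp-↭ R-sym ↭.refl          rxs = rxs
AllPairs-resp-↭ R-sym (↭.prep _ π)    (rx ∷ rxs) = All-resp-↭ π rx ∷ AllPairs-resp-↭ R-sym π rxs
AllPairs-resp-↭ R-sym (↭.swap _ _ π)  ((rxy ∷ rx) ∷ ry ∷ rxs) =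
  (R-sym rxy ∷ All-resp-↭ π ry) ∷ All-resp-↭ π rx ∷ AllPairs-resp-↭ R-sym π rxs
AllPairs-resp-↭ R-sym (↭.trans π₁ π₂) rxs = AllPairs-resp-↭ R-sym π₂ (AllPairs-resp-↭ R-sym π₁ rxs)

All-lookup : {P : A → Set r} {xs : List A} → All P xs → (i : Fin (length xs)) → P (lookup xs i)
All-lookup pxs i = All.lookup pxs (∈-lookup i)

lookup-All : {P : A → Set r} {xs : List A} → ((i : Fin (length xs)) → P (lookup xs i)) → All P xs
lookup-All {P = P} {xs} pxs = subst (All P) (tabulate-lookup xs) (tabulate⁺ pxs)

lookup-map : ∀ (f : A → B) xs (i : Fin (length (map f xs))) →
             lookup (map f xs) i ≡ f (lookup xs (cast (length-map f xs) i))
lookup-map f (x ∷ xs) zero    = refl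
lookup-map f (x ∷ xs) (suc i) = lookup-map f xs i

-- Fin.cast ignores its irrelevant proof, so iso (suc i) (suc j) already has the required type.
OrderIso-∷⁻ : ∀ {x y s q} → OrderIso (x ∷ s) (y ∷ q) → OrderIso s q
OrderIso-∷⁻ (eq , iso) = suc-injective eq , λ i j → iso (suc i) (suc j)

OrderIso-∷⁺ : ∀ {x y s q} → OrderIso s q → All (x <_) s → All (y <_) q → OrderIso (x ∷ s) (y ∷ q)
OrderIso-∷⁺ {x} {y} {s} {q} (eq , iso) x<s y<q = cong suc eq , iso′
  where
  iso′ : (i j : Fin (suc (length s))) →
         (lookup (x ∷ s) i < lookup (x ∷ s) j) ⇔
         (lookup (y ∷ q) (cast (cong suc eq) i) < lookup (y ∷ q) (cast (cong suc eq) j))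
  iso′ zero    zero    = mk⇔ (⊥-elim ∘ <-irrefl refl) (⊥-elim ∘ <-irrefl refl)
  iso′ zero    (suc j) = mk⇔ (λ _ → All-lookup y<q (cast eq j)) (λ _ → All-lookup x<s j)
  iso′ (suc i) zero    = mk⇔ (⊥-elim ∘ <-asym (All-lookup x<s i))
                             (⊥-elim ∘ <-asym (All-lookup y<q (cast eq i)))
  iso′ (suc i) (suc j) = iso i j

OrderIso-head-< : ∀ {x y s q} → OrderIso (x ∷ s) (y ∷ q) → All (y <_) q → All (x <_) s
OrderIso-head-< (_ , iso) y<q =
  lookup-All λ i → Equivalence.from (iso zero (suc i)) (All-lookup y<q _)

OrderIso-head-≤ : ∀ {x y s q} → OrderIso (x ∷ s) (y ∷ q) → All (y ≤_) q → All (x ≤_) s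
OrderIso-head-≤ (_ , iso) y≤q =
  lookup-All λ i → ≮⇒≥ (≤⇒≯ (All-lookup y≤q _) ∘ Equivalence.to (iso (suc i) zero))

module _ {f : ℕ → ℕ} (f-embedding : ∀ {m n} → m < n ⇔ f m < f n) where

  OrderIso-map⁺ : ∀ {s q} → OrderIso s q → OrderIso s (map f q)
  OrderIso-map⁺ {s} {q} (eq , iso) = eq′ , λ i j →
    subst₂ (λ u v → _ ⇔ u < v) (sym (lookup-map-cast i)) (sym (lookup-map-cast j))
      (f-embedding ⇔-∘ iso i j)
    where
    eq′ : length s ≡ length (map f q)
    eq′ = trans eq (sym (length-map f q))
    lookup-map-cast : ∀ i → lookup (map f q) (cast eq′ i) ≡ f (lookup q (cast eq i))
    lookup-map-cast i = trans (lookup-map f q (cast eq′ i))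
                              (cong (f ∘ lookup q) (cast-trans eq′ (length-map f q) i))

  OrderIso-map⁻ : ∀ {s q} → OrderIso s (map f q) → OrderIso s q
  OrderIso-map⁻ {s} {q} (eq , iso) = eq′ , λ i j →
    ⇔-sym f-embedding ⇔-∘
      subst₂ (λ u v → _ ⇔ u < v) (lookup-map-cast i) (lookup-map-cast j) (iso i j)
    where
    eq′ : length s ≡ length q
    eq′ = trans eq (length-map f q)
    lookup-map-cast : ∀ i → lookup (map f q) (cast eq i) ≡ f (lookup q (cast eq′ i))
    lookup-map-cast i = trans (lookup-map f q (cast eq i))
                              (cong (f ∘ lookup q) (cast-trans eq (length-map f q) i))

all-<ᵇ-false : ∀ {z x acc} → z ∈ acc → z < x → ¬ T (all (x <ᵇ_) acc)
all-<ᵇ-false {z} {x} {acc} z∈acc z<x all-x<acc =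
  <-asym z<x (<ᵇ⇒< x z (All.lookup (all⁺ (x <ᵇ_) acc all-x<acc) z∈acc))

¬all-<ᵇ⇒∃≤ : ∀ {x} acc → ¬ T (all (x <ᵇ_) acc) → ∃ λ z → z ∈ acc × z ≤ x
¬all-<ᵇ⇒∃≤ {x} acc ¬all-x<acc with find (¬All⇒Any¬ (T? ∘ (x <ᵇ_)) acc (¬all-x<acc ∘ all⁻ (x <ᵇ_)))
... | z , z∈acc , x≮z = z , z∈acc , ≮⇒≥ (x≮z ∘ <⇒<ᵇ)

remaining-from-⊆ : ∀ acc p → remaining-from acc p ⊆ p
remaining-from-⊆ acc []       = []
remaining-from-⊆ acc (x ∷ xs) with all (x <ᵇ_) acc
... | true  = x ∷ʳ remaining-from-⊆ (acc ++ [ x ]) xs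
... | false = refl ∷ remaining-from-⊆ (acc ++ [ x ]) xs

⊆-remaining-from : ∀ {z t} acc p → z ∈ acc → All (z <_) t → t ⊆ p → t ⊆ remaining-from acc p
⊆-remaining-from acc [] z∈acc z<t [] = []
⊆-remaining-from acc (x ∷ xs) z∈acc z<t (.x ∷ʳ τ) =
  ++⁺ˡ _ (⊆-remaining-from (acc ++ [ x ]) xs (∈-++⁺ˡ z∈acc) z<t τ)
⊆-remaining-from acc (x ∷ xs) z∈acc (z<x ∷ z<t) (refl ∷ τ) with all (x <ᵇ_) acc in eq
... | true  = ⊥-elim (all-<ᵇ-false z∈acc z<x (subst T (sym eq) _))
... | false = refl ∷ ⊆-remaining-from (acc ++ [ x ]) xs (∈-++⁺ˡ z∈acc) z<t τ

⊆-remaining-from-after : ∀ {y t} acc p → y ∷ t ⊆ p → All (y <_) t → t ⊆ remaining-from acc p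
⊆-remaining-from-after acc (x ∷ xs) (.x ∷ʳ τ) y<t =
  ++⁺ˡ _ (⊆-remaining-from-after (acc ++ [ x ]) xs τ y<t)
⊆-remaining-from-after acc (x ∷ xs) (refl ∷ τ) x<t =
  ++⁺ˡ _ (⊆-remaining-from (acc ++ [ x ]) xs (∈-++⁺ʳ acc (here refl)) x<t τ)

PrecededByLower : ℕ → List ℕ → List ℕ → Set
PrecededByLower x t ys = ∃ λ y → y ≤ x × y ∷ x ∷ t ⊆ ys

remaining-from-preceded : ∀ {x t} acc p → x ∷ t ⊆ remaining-from acc p → PrecededByLower x t (acc ++ p)
remaining-from-preceded {x} {t} acc (z ∷ zs) τ with all (z <ᵇ_) acc in eq | τ
... | true  | τ′       = subst (PrecededByLower x t) (++-assoc acc [ z ] zs)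
                           (remaining-from-preceded (acc ++ [ z ]) zs τ′)
... | false | _ ∷ʳ τ′  = subst (PrecededByLower x t) (++-assoc acc [ z ] zs)
                           (remaining-from-preceded (acc ++ [ z ]) zs τ′)
... | false | refl ∷ τ′ with ¬all-<ᵇ⇒∃≤ acc (subst T eq)
...   | y , y∈acc , y≤z = y , y≤z , ++⁺ (from∈ y∈acc) (refl ∷ ⊆-trans τ′ (remaining-from-⊆ _ zs))

suc-embedding : ∀ {m n} → m < n ⇔ suc m < suc n
suc-embedding = mk⇔ s<s s<s⁻¹

Contains-shiftPattern⇒Contains-remaining : ∀ {p q} → All (1 ≤_) q →
  Contains p (shiftPattern q) → Contains (remaining p) q
Contains-shiftPattern⇒Contains-remaining _ ([] , _ , () , _)
Contains-shiftPattern⇒Contains-remaining {p} {q} q≥1 (y ∷ t , τ , iso) =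
  t , ⊆-remaining-from-after [] p τ y<t , OrderIso-map⁻ suc-embedding {t} {q} (OrderIso-∷⁻ iso)
  where
  y<t : All (y <_) t
  y<t = OrderIso-head-< iso (All.map⁺ (All.map s≤s q≥1))

Contains-remaining⇒Contains-shiftPattern : ∀ {p rest} → Unique p → All (1 ≤_) rest →
  Contains (remaining p) (1 ∷ rest) → Contains p (shiftPattern (1 ∷ rest))
Contains-remaining⇒Contains-shiftPattern _ _ ([] , _ , () , _)
Contains-remaining⇒Contains-shiftPattern {p} {rest} p-unique rest≥1 (x ∷ t , τ , iso)
  with remaining-from-preceded [] p τ
... | y , y≤x , σ = y ∷ x ∷ t , σ , OrderIso-∷⁺ (OrderIso-map⁺ suc-embedding iso) y<x∷t 1<shifted
  where
  y≢x : y ≢ x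
  y≢x with AllPairs-resp-⊆ σ p-unique
  ... | (y≢x ∷ _) ∷ _ = y≢x
  y<x∷t : All (y <_) (x ∷ t)
  y<x∷t = let y<x = ≤∧≢⇒< y≤x y≢x in
          y<x ∷ All.map (<-≤-trans y<x) (OrderIso-head-≤ iso rest≥1)
  1<shifted : All (1 <_) (map suc (1 ∷ rest))
  1<shifted = All.map⁺ (All.map s≤s (s≤s z≤n ∷ rest≥1))

IsPerm⇒All-≥1 : ∀ {p} → IsPerm p → All (1 ≤_) p
IsPerm⇒All-≥1 {p} p-perm =
  All-resp-↭ (↭-sym p-perm) (All.map⁺ (All.universal (λ _ → s≤s z≤n) (upTo (length p))))

IsPerm⇒Unique : ∀ {p} → IsPerm p → Unique p
IsPerm⇒Unique {p} p-perm =
  AllPairs-resp-↭ ≢-sym (↭-sym p-perm) (Unique.map⁺ suc-injective (upTo⁺ (length p)))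

proposition5p1 : (q : List ℕ) → IsPerm q → (∃ λ rest → q ≡ 1 ∷ rest) →
    (p : List ℕ) → IsPerm p →
    (Avoids (remaining p) q → Avoids p (shiftPattern q))
    × (Avoids p (shiftPattern q) ⇔ Avoids (remaining p) q)
proposition5p1 q q-perm (rest , refl) p p-perm =
  avoids-shifted , mk⇔ (λ avoid → avoid ∘ contains-shifted) avoids-shifted
  where
  q≥1 : All (1 ≤_) q
  q≥1 = IsPerm⇒All-≥1 q-perm
  avoids-shifted : Avoids (remaining p) q → Avoids p (shiftPattern q)
  avoids-shifted avoid = avoid ∘ Contains-shiftPattern⇒Contains-remaining q≥1
  contains-shifted : Contains (remaining p) q → Contains p (shiftPattern q)
  contains-shifted = Contains-remaining⇒Contains-shiftPattern (IsPerm⇒Unique p-perm) (All.tail q≥1)
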